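{- For every $n\in\mathbb{Z}$ there exists a unique odd-length word $w\in\Sigma(\Sigma\Sigma)^*\setminus\left(\Sigma^*11\Sigma^*\cup000\Sigma^*\cup101\Sigma^*\right)$ such that $n=\operatorname{val}_\mathcal{F}(w)$.
   Context: $\Sigma=\{0,1\}$. Fibonacci numbers: $F_0=1$, $F_1=1$, $F_{n+2}=F_{n+1}+F_n$ for $n\ge0$. For an odd-length binary word $w=w_{2k+1}w_{2k}\cdots w_1$ (digits indexed from right to left, $k\ge0$), $\operatorname{val}_\mathcal{F}(w)=\sum_{i=1}^{2k}w_iF_i-w_{2k+1}F_{2k}$. -}

module Defs where

open import Data.Bool using (Bool; true; false)
open import Data.Nat as ℕ using (ℕ; zero; suc)
open import Data.Integer as ℤ using (ℤ; +_)
open import Data.List using (List; []; _∷_; _++_; length)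
open import Data.Product using (∃-syntax; _×_)
open import Relation.Binary.PropositionalEquality using (_≡_)
open import Relation.Nullary using (¬_)

Σ : Set
Σ = Bool

-- A word is a list of digits written as in the paper, most significant
-- digit first: w = w_{m} w_{m-1} ... w_1  is  w_m ∷ ... ∷ w_1 ∷ [].
Word : Set
Word = List Σ

digit : Σ → ℕ
digit false = 0
digit true  = 1

F : ℕ → ℕ
F zero          = 1
F (suc zero)    = 1
F (suc (suc n)) = F (suc n) ℕ.+ F n

posVal : Word → ℕ
posVal []      = 0
posVal (d ∷ w) = digit d ℕ.* F (suc (length w)) ℕ.+ posVal w

-- val_F (w_{2k+1} w_{2k} ... w_1) = Σ_{i=1}^{2k} w_i F_i - w_{2k+1} F_{2k}
-- (the empty word, which is never in the language considered, gets 0)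
valF : Word → ℤ
valF []      = + 0
valF (d ∷ w) = + posVal w ℤ.- + (digit d ℕ.* F (length w))

OddLength : Word → Set
OddLength w = ∃[ k ] length w ≡ suc (k ℕ.+ k)

HasFactor11 : Word → Set
HasFactor11 w = ∃[ u ] ∃[ v ] w ≡ u ++ (true ∷ true ∷ v)

HasPrefix000 : Word → Set
HasPrefix000 w = ∃[ v ] w ≡ false ∷ false ∷ false ∷ v

HasPrefix101 : Word → Set
HasPrefix101 w = ∃[ v ] w ≡ true ∷ false ∷ true ∷ v

InLang : Word → Set
InLang w = OddLength w × ¬ HasFactor11 w × ¬ HasPrefix000 w × ¬ HasPrefix101 w

module Submission where

-- Write w = d t with |t| = 2j.  If d = 0, excluding 000 says that t does not
-- start with 00, and then val w = Σ t_i F_i ranges exactly over the interval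
-- [F_{2j-1}, F_{2j+1}) (read [0, 1) for j = 0).  If d = 1, excluding 11 and 101
-- leaves w = 1 or w = 100u, whose values -1 and Σ u_i F_i - F_{2j} range over
-- [-F_{2j}, -F_{2j-2}).  These intervals tile ℤ, and inside each of them the
-- digits are the fixed-length Zeckendorf representation of the value, which
-- exists and is unique.

open import Data.Bool using (true; false)
open import Data.Empty using (⊥-elim)
open import Data.Integer as ℤ using (ℤ; -[1+_]; _⊖_)
import Data.Integer.Properties as ℤP
open import Data.List using ([]; _∷_; _++_; length)
open import Data.List.Properties using (∷-injectiveʳ; ++-assoc)
open import Data.Nat
  using (ℕ; zero; suc; _+_; _*_; _∸_; _≤_; _<_; _≤′_; ≤′-refl; ≤′-step; z≤n; s≤s; s≤s⁻¹; z<s; _<?_; >-nonZero)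
open import Data.Nat.Properties
open import Data.Product using (∃-syntax; _×_; _,_)
open import Function.Base using (_∘_)
open import Relation.Binary.Definitions using (tri<; tri≈; tri>)
open import Relation.Binary.PropositionalEquality
  using (_≡_; refl; sym; trans; cong; subst; module ≡-Reasoning)
open import Relation.Nullary using (¬_; yes; no)

open import Defs

stepwise-mono : (f : ℕ → ℕ) → (∀ n → f n ≤ f (suc n)) → ∀ {m n} → m ≤ n → f m ≤ f n
stepwise-mono f f-step = go ∘ ≤⇒≤′
  where
  go : ∀ {m n} → m ≤′ n → f m ≤ f n
  go ≤′-refl         = ≤-refl
  go (≤′-step m≤′n) = ≤-trans (go m≤′n) (f-step _)

m⊖[m+1+n]≡-[1+n] : ∀ m n → m ⊖ (m + suc n) ≡ -[1+ n ]
m⊖[m+1+n]≡-[1+n] m n = trans (ℤP.⊖-< (m<m+n m z<s)) (cong (ℤ.-_ ∘ ℤ.+_) (m+n∸m≡n m (suc n)))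

module Blocks (s : ℕ → ℕ) (s-zero : s 0 ≡ 0) (s-< : ∀ j → s j < s (suc j)) where

  _∈Block_ : ℕ → ℕ → Set
  m ∈Block j = s j ≤ m × m < s (suc j)

  block : ∀ m → ∃[ j ] m ∈Block j
  block zero = 0 , ≤-reflexive s-zero , subst (_< s 1) s-zero (s-< 0)
  block (suc m) with block m
  ... | j , sj≤m , m<sj+1 with suc m <? s (suc j)
  ...   | yes 1+m<sj+1 = j , m≤n⇒m≤1+n sj≤m , 1+m<sj+1
  ...   | no 1+m≮sj+1  = suc j , ≮⇒≥ 1+m≮sj+1 , ≤-<-trans m<sj+1 (s-< (suc j))

  private
    s-mono : ∀ {i j} → i ≤ j → s i ≤ s j
    s-mono = stepwise-mono s (<⇒≤ ∘ s-<)

  block-unique : ∀ {m i j} → m ∈Block i → m ∈Block j → i ≡ j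
  block-unique {i = i} {j} (si≤m , m<si+1) (sj≤m , m<sj+1) with <-cmp i j
  ... | tri< i<j _ _ = ⊥-elim (<⇒≱ (<-≤-trans m<si+1 (s-mono i<j)) sj≤m)
  ... | tri≈ _ i≡j _ = i≡j
  ... | tri> _ _ j<i = ⊥-elim (<⇒≱ (<-≤-trans m<sj+1 (s-mono j<i)) si≤m)

0<F[n] : ∀ n → 0 < F n
0<F[n] zero          = s≤s z≤n
0<F[n] (suc zero)    = s≤s z≤n
0<F[n] (suc (suc n)) = ≤-trans (0<F[n] (suc n)) (m≤m+n _ _)

F[n]≤F[1+n] : ∀ n → F n ≤ F (suc n)
F[n]≤F[1+n] zero    = ≤-refl
F[n]≤F[1+n] (suc n) = m≤m+n _ _

F[n]<F[2+n] : ∀ n → F n < F (suc (suc n))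
F[n]<F[2+n] n = m<n+m (F n) (0<F[n] (suc n))

F[2+L]≡p+1+m⇒F[L]≤m : ∀ {p L m} → p < F (suc L) → p + suc m ≡ F (suc (suc L)) → F L ≤ m
F[2+L]≡p+1+m⇒F[L]≤m {p} {L} {m} p<F eq = +-cancelˡ-≤ (F (suc L)) (F L) m (begin
  F (suc L) + F L ≡⟨ eq ⟨
  p + suc m       ≡⟨ +-suc p m ⟩
  suc p + m       ≤⟨ +-monoˡ-≤ m p<F ⟩
  F (suc L) + m   ∎)
  where open ≤-Reasoning

F[L]≤m⇒F[2+L]∸1+m<F[1+L] : ∀ {L m} → F L ≤ m → F (suc (suc L)) ∸ suc m < F (suc L)
F[L]≤m⇒F[2+L]∸1+m<F[1+L] {L} {m} F≤m =
  m<n+o⇒m∸n<o _ (suc m) {{>-nonZero (0<F[n] (suc L))}}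
    (subst (F (suc (suc L)) <_) (+-comm (F (suc L)) (suc m)) (+-monoʳ-< (F (suc L)) (s≤s F≤m)))

posVal-true∷ : ∀ w → posVal (true ∷ w) ≡ F (suc (length w)) + posVal w
posVal-true∷ w = cong (_+ posVal w) (+-identityʳ _)

F≤posVal-true∷ : ∀ w → F (suc (length w)) ≤ posVal (true ∷ w)
F≤posVal-true∷ w = ≤-trans (m≤m+n _ (posVal w)) (≤-reflexive (sym (posVal-true∷ w)))

valF-true∷ : ∀ w → valF (true ∷ w) ≡ posVal w ⊖ F (length w)
valF-true∷ w =
  trans (ℤP.m-n≡m⊖n (posVal w) (1 * F (length w))) (cong (posVal w ⊖_) (*-identityˡ (F (length w))))

data No11 : Word → Set where
  []   : No11 []
  [1]  : No11 (true ∷ [])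
  0∷_  : ∀ {w} → No11 w → No11 (false ∷ w)
  10∷_ : ∀ {w} → No11 w → No11 (true ∷ false ∷ w)

HasFactor11-++ : ∀ p {w} → HasFactor11 w → HasFactor11 (p ++ w)
HasFactor11-++ p (u , v , refl) = p ++ u , v , sym (++-assoc p u _)

No11⇒¬HasFactor11 : ∀ {w} → No11 w → ¬ HasFactor11 w
No11⇒¬HasFactor11 (0∷ nw)  (_ ∷ u , v , eq)     = No11⇒¬HasFactor11 nw (u , v , ∷-injectiveʳ eq)
No11⇒¬HasFactor11 (10∷ nw) (_ ∷ _ ∷ u , v , eq) = No11⇒¬HasFactor11 nw (u , v , ∷-injectiveʳ (∷-injectiveʳ eq))
No11⇒¬HasFactor11 []       ([] , _ , ())
No11⇒¬HasFactor11 []       (_ ∷ _ , _ , ())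
No11⇒¬HasFactor11 [1]      ([] , _ , ())
No11⇒¬HasFactor11 [1]      (_ ∷ [] , _ , ())
No11⇒¬HasFactor11 [1]      (_ ∷ _ ∷ _ , _ , ())
No11⇒¬HasFactor11 (0∷ _)   ([] , _ , ())
No11⇒¬HasFactor11 (10∷ _)  ([] , _ , ())
No11⇒¬HasFactor11 (10∷ _)  (_ ∷ [] , _ , ())

¬HasFactor11⇒No11 : ∀ w → ¬ HasFactor11 w → No11 w
¬HasFactor11⇒No11 []                 _   = []
¬HasFactor11⇒No11 (false ∷ w)        ¬11 = 0∷ ¬HasFactor11⇒No11 w (¬11 ∘ HasFactor11-++ (false ∷ []))
¬HasFactor11⇒No11 (true ∷ [])        _   = [1]
¬HasFactor11⇒No11 (true ∷ true ∷ w)  ¬11 = ⊥-elim (¬11 ([] , w , refl))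
¬HasFactor11⇒No11 (true ∷ false ∷ w) ¬11 = 10∷ ¬HasFactor11⇒No11 w (¬11 ∘ HasFactor11-++ (true ∷ false ∷ []))

No11-tail : ∀ {d w} → No11 (d ∷ w) → No11 w
No11-tail [1]      = []
No11-tail (0∷ nw)  = nw
No11-tail (10∷ nw) = 0∷ nw

posVal-< : ∀ {w} → No11 w → posVal w < F (suc (length w))
posVal-< []              = s≤s z≤n
posVal-< [1]             = s≤s (s≤s z≤n)
posVal-< (0∷_ {w} nw)    = <-≤-trans (posVal-< nw) (F[n]≤F[1+n] (suc (length w)))
posVal-< (10∷_ {w} nw)   = subst (_< F (suc (suc (suc (length w))))) (sym (posVal-true∷ (false ∷ w)))
                                 (+-monoʳ-< (F (suc (suc (length w)))) (posVal-< nw))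

posVal-<-posVal-true∷ : ∀ {u v} → No11 v → length v ≡ length u → posVal v < posVal (true ∷ u)
posVal-<-posVal-true∷ {u} {v} nv lv =
  <-≤-trans (subst (λ L → posVal v < F (suc L)) lv (posVal-< nv)) (F≤posVal-true∷ u)

zeckendorf : ∀ L m → m < F (suc L) → ∃[ w ] (No11 w × length w ≡ L × posVal w ≡ m)
zeckendorf zero zero _ = [] , [] , refl , refl
zeckendorf zero (suc m) (s≤s ())
zeckendorf (suc L) m m<F with m <? F (suc L)
... | yes m<F′ with zeckendorf L m m<F′
...   | w , nw , lw , pw = false ∷ w , 0∷ nw , cong suc lw , pw
zeckendorf (suc zero) m m<F | no m≮F = true ∷ [] , [1] , refl , ≤-antisym (≮⇒≥ m≮F) (s≤s⁻¹ m<F)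
zeckendorf (suc (suc L)) m m<F | no m≮F
  with zeckendorf L (m ∸ F (suc (suc L))) (m<n+o⇒m∸n<o m _ {{>-nonZero (0<F[n] (suc L))}} m<F)
...   | w , nw , refl , pw = true ∷ false ∷ w , 10∷ nw , refl , (begin
  posVal (true ∷ false ∷ w)                                 ≡⟨ posVal-true∷ (false ∷ w) ⟩
  F (suc (suc (length w))) + posVal w                       ≡⟨ cong (F (suc (suc (length w))) +_) pw ⟩
  F (suc (suc (length w))) + (m ∸ F (suc (suc (length w)))) ≡⟨ m+[n∸m]≡n (≮⇒≥ m≮F) ⟩
  m                                                         ∎)
  where open ≡-Reasoning

zeckendorf-unique : ∀ {u v} → No11 u → No11 v → length u ≡ length v → posVal u ≡ posVal v → u ≡ v
zeckendorf-unique {[]}        {[]}        _  _  _  _  = refl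
zeckendorf-unique {false ∷ u} {false ∷ v} nu nv lu pu =
  cong (false ∷_) (zeckendorf-unique (No11-tail nu) (No11-tail nv) (suc-injective lu) pu)
zeckendorf-unique {true ∷ u}  {true ∷ v}  nu nv lu pu =
  cong (true ∷_) (zeckendorf-unique (No11-tail nu) (No11-tail nv) (suc-injective lu)
                   (+-cancelˡ-≡ (F (suc (length u))) _ _ (begin
    F (suc (length u)) + posVal u ≡⟨ posVal-true∷ u ⟨
    posVal (true ∷ u)             ≡⟨ pu ⟩
    posVal (true ∷ v)             ≡⟨ posVal-true∷ v ⟩
    F (suc (length v)) + posVal v ≡⟨ cong (λ L → F (suc L) + posVal v) (suc-injective lu) ⟨
    F (suc (length u)) + posVal v ∎)))
  where open ≡-Reasoning
zeckendorf-unique {true ∷ u}  {false ∷ v} _  nv lu pu =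
  ⊥-elim (<-irrefl (sym pu) (posVal-<-posVal-true∷ {u} (No11-tail nv) (sym (suc-injective lu))))
zeckendorf-unique {false ∷ u} {true ∷ v}  nu _  lu pu =
  ⊥-elim (<-irrefl pu (posVal-<-posVal-true∷ {v} (No11-tail nu) (suc-injective lu)))

double : ℕ → ℕ
double zero    = 0
double (suc k) = suc (suc (double k))

double≡n+n : ∀ k → double k ≡ k + k
double≡n+n zero    = refl
double≡n+n (suc k) = cong suc (trans (cong suc (double≡n+n k)) (sym (+-suc k k)))

OddLength⇒double : ∀ d t → OddLength (d ∷ t) → ∃[ k ] length t ≡ double k
OddLength⇒double _ _ (k , eq) = k , trans (suc-injective eq) (sym (double≡n+n k))

double⇒OddLength : ∀ d t {k} → length t ≡ double k → OddLength (d ∷ t)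
double⇒OddLength _ _ {k} eq = k , cong suc (trans eq (double≡n+n k))

-- A word 0t with |t| = double j has value in block j of nonnegStart; the words
-- 1 and 100u with |u| = double k have value -[1+ m ] with m in block 0, resp.
-- block (suc k), of negStart.
nonnegStart : ℕ → ℕ
nonnegStart zero    = 0
nonnegStart (suc j) = F (suc (double j))

negStart : ℕ → ℕ
negStart zero    = 0
negStart (suc j) = F (double j)

nonnegStart-< : ∀ j → nonnegStart j < nonnegStart (suc j)
nonnegStart-< zero    = s≤s z≤n
nonnegStart-< (suc j) = F[n]<F[2+n] (suc (double j))

negStart-< : ∀ j → negStart j < negStart (suc j)
negStart-< zero    = s≤s z≤n
negStart-< (suc j) = F[n]<F[2+n] (double j)

module Nonneg = Blocks nonnegStart refl nonnegStart-<
module Neg    = Blocks negStart refl negStart-<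

¬000⇒nonnegStart≤posVal : ∀ j {t} → length t ≡ double j → ¬ HasPrefix000 (false ∷ t) →
                          nonnegStart j ≤ posVal t
¬000⇒nonnegStart≤posVal zero    _ _ = z≤n
¬000⇒nonnegStart≤posVal (suc j) {true ∷ t} lt _ =
  ≤-trans (subst (λ L → F (suc (double j)) ≤ F (suc L)) (sym (suc-injective lt)) (F[n]≤F[1+n] (suc (double j))))
          (F≤posVal-true∷ t)
¬000⇒nonnegStart≤posVal (suc j) {false ∷ true ∷ t} lt _ =
  subst (λ L → F (suc L) ≤ posVal (true ∷ t)) (suc-injective (suc-injective lt)) (F≤posVal-true∷ t)
¬000⇒nonnegStart≤posVal (suc j) {false ∷ false ∷ t} _ ¬000 = ⊥-elim (¬000 (t , refl))

nonnegStart≤posVal⇒¬000 : ∀ {j t} → No11 t → length t ≡ double j → nonnegStart j ≤ posVal t →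
                          ¬ HasPrefix000 (false ∷ t)
nonnegStart≤posVal⇒¬000 {suc j} (0∷ 0∷_ {v} nv) lt lb (_ , refl) =
  <⇒≱ (subst (λ L → posVal v < F (suc L)) (suc-injective (suc-injective lt)) (posVal-< nv)) lb

data Canonical : ℤ → Word → Set where
  nonneg    : ∀ j {m t} → No11 t → length t ≡ double j → posVal t ≡ m → nonnegStart j ≤ m →
              Canonical (ℤ.+ m) (false ∷ t)
  minus-one : Canonical -[1+ 0 ] (true ∷ [])
  neg       : ∀ k {m u} → No11 u → length u ≡ double k →
              posVal u + suc m ≡ F (suc (suc (length u))) → Canonical -[1+ m ] (true ∷ false ∷ false ∷ u)

Canonical⇒valF : ∀ {n w} → Canonical n w → valF w ≡ n
Canonical⇒valF (nonneg _ _ _ pt _)     = cong ℤ.+_ (trans (+-identityʳ _) pt)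
Canonical⇒valF minus-one               = refl
Canonical⇒valF (neg _ {m} {u} _ _ eq) = begin
  valF (true ∷ false ∷ false ∷ u)     ≡⟨ valF-true∷ (false ∷ false ∷ u) ⟩
  posVal u ⊖ F (suc (suc (length u))) ≡⟨ cong (posVal u ⊖_) eq ⟨
  posVal u ⊖ (posVal u + suc m)       ≡⟨ m⊖[m+1+n]≡-[1+n] (posVal u) m ⟩
  -[1+ m ]                            ∎
  where open ≡-Reasoning

Canonical⇒InLang : ∀ {n w} → Canonical n w → InLang w
Canonical⇒InLang (nonneg _ {t = t} nt lt refl lb) =
    double⇒OddLength false t lt , No11⇒¬HasFactor11 (0∷ nt) , nonnegStart≤posVal⇒¬000 nt lt lb
  , λ { (_ , ()) }
Canonical⇒InLang minus-one =
  (0 , refl) , No11⇒¬HasFactor11 [1] , (λ { (_ , ()) }) , λ { (_ , ()) }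
Canonical⇒InLang (neg k {u = u} nu lu _) =
    double⇒OddLength true (false ∷ false ∷ u) {suc k} (cong (suc ∘ suc) lu) , No11⇒¬HasFactor11 (10∷ 0∷ nu)
  , (λ { (_ , ()) }) , λ { (_ , ()) }

atValF : ∀ {n w} → Canonical n w → Canonical (valF w) w
atValF {w = w} c = subst (λ n → Canonical n w) (sym (Canonical⇒valF c)) c

InLang⇒Canonical : ∀ {w} → InLang w → Canonical (valF w) w
InLang⇒Canonical {[]} ((_ , ()) , _)
InLang⇒Canonical {false ∷ t} (odd , ¬11 , ¬000 , _) with OddLength⇒double false t odd
... | j , lt = atValF (nonneg j (¬HasFactor11⇒No11 t (¬11 ∘ HasFactor11-++ (false ∷ []))) lt refl
                                (¬000⇒nonnegStart≤posVal j lt ¬000))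
InLang⇒Canonical {true ∷ []} _ = minus-one
InLang⇒Canonical {true ∷ true ∷ t} (_ , ¬11 , _) = ⊥-elim (¬11 ([] , t , refl))
InLang⇒Canonical {true ∷ false ∷ true ∷ t} (_ , _ , _ , ¬101) = ⊥-elim (¬101 (t , refl))
InLang⇒Canonical {true ∷ false ∷ []} (odd , _) with OddLength⇒double true (false ∷ []) odd
... | zero , ()
... | suc _ , ()
InLang⇒Canonical {true ∷ false ∷ false ∷ u} (odd , ¬11 , _) with OddLength⇒double true (false ∷ false ∷ u) odd
... | suc k , lu =
  atValF (neg k nu (suc-injective (suc-injective lu)) (trans (+-suc (posVal u) _) (m+[n∸m]≡n posVal<F)))
  where
  nu : No11 u
  nu = ¬HasFactor11⇒No11 u (¬11 ∘ HasFactor11-++ (true ∷ false ∷ false ∷ []))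
  posVal<F : posVal u < F (suc (suc (length u)))
  posVal<F = <-≤-trans (posVal-< nu) (F[n]≤F[1+n] (suc (length u)))

nonneg-block : ∀ j {m t} → No11 t → length t ≡ double j → posVal t ≡ m → nonnegStart j ≤ m →
               m Nonneg.∈Block j
nonneg-block _ {t = t} nt lt refl lb = lb , subst (λ L → posVal t < F (suc L)) lt (posVal-< nt)

neg-block : ∀ k {m u} → No11 u → length u ≡ double k → posVal u + suc m ≡ F (suc (suc (length u))) →
            m Neg.∈Block suc k
neg-block _ {m} {u} nu lu eq =
    subst (λ L → F L ≤ m) lu (F[2+L]≡p+1+m⇒F[L]≤m {L = length u} (posVal-< nu) eq)
  , subst (λ L → m < F (suc (suc L))) lu (≤-trans (m≤n+m (suc m) (posVal u)) (≤-reflexive eq))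

Canonical-unique : ∀ {n u v} → Canonical n u → Canonical n v → u ≡ v
Canonical-unique (nonneg j nt lt pt lb) (nonneg j′ nt′ lt′ pt′ lb′)
  with Nonneg.block-unique {i = j} {j′} (nonneg-block j nt lt pt lb)
                                         (nonneg-block j′ nt′ lt′ pt′ lb′)
... | refl = cong (false ∷_) (zeckendorf-unique nt nt′ (trans lt (sym lt′)) (trans pt (sym pt′)))
Canonical-unique minus-one minus-one = refl
Canonical-unique minus-one (neg k nu lu eq)
  with Neg.block-unique {i = 0} {suc k} (z≤n , s≤s z≤n) (neg-block k nu lu eq)
... | ()
Canonical-unique (neg k nu lu eq) minus-one
  with Neg.block-unique {i = 0} {suc k} (z≤n , s≤s z≤n) (neg-block k nu lu eq)
... | ()
Canonical-unique (neg k {m} nu lu eq) (neg k′ nu′ lu′ eq′)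
  with Neg.block-unique {i = suc k} {suc k′} (neg-block k nu lu eq) (neg-block k′ nu′ lu′ eq′)
... | refl = cong (λ w → true ∷ false ∷ false ∷ w) (zeckendorf-unique nu nu′ |u|≡|u′|
               (+-cancelʳ-≡ (suc m) _ _ (trans eq (trans (cong (λ L → F (suc (suc L))) |u|≡|u′|) (sym eq′)))))
  where |u|≡|u′| = trans lu (sym lu′)

existence : ∀ n → ∃[ w ] Canonical n w
existence (ℤ.+ m) with Nonneg.block m
... | j , lb , m<F with zeckendorf (double j) m m<F
...   | t , nt , lt , pt = false ∷ t , nonneg j nt lt pt lb
existence -[1+ m ] with Neg.block m
... | zero , _ , s≤s z≤n = true ∷ [] , minus-one
... | suc k , lb , m<F
  with zeckendorf (double k) (F (suc (suc (double k))) ∸ suc m) (F[L]≤m⇒F[2+L]∸1+m<F[1+L] {double k} lb)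
...   | u , nu , lu , pu = true ∷ false ∷ false ∷ u , neg k nu lu (begin
  posVal u + suc m                         ≡⟨ cong (_+ suc m) pu ⟩
  F (suc (suc (double k))) ∸ suc m + suc m ≡⟨ m∸n+n≡m m<F ⟩
  F (suc (suc (double k)))                 ≡⟨ cong (λ L → F (suc (suc L))) lu ⟨
  F (suc (suc (length u)))                 ∎)
  where open ≡-Reasoning

proposition1 : (n : ℤ) → ∃[ w ] ((InLang w × n ≡ valF w) × (∀ w′ → InLang w′ → n ≡ valF w′ → w′ ≡ w))
proposition1 n with existence n
... | w , c = w , (Canonical⇒InLang c , sym (Canonical⇒valF c)) ,
              λ w′ w′∈L n≡valF → Canonical-unique (subst (λ x → Canonical x w′) (sym n≡valF)
                                                         (InLang⇒Canonical w′∈L)) c
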